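{- Let $(X,f)$ be a connectivity system with $X$ a non-empty finite set, and let $k$ be a nonnegative integer. Then there exists at least one ultrafilter of order $k+1$ on $(X,f)$.
   Context: A connectivity system is a pair $(X,f)$ where $X$ is a finite set and $f:2^X\to\mathbb{N}$ is symmetric ($f(A)=f(X\setminus A)$ for all $A\subseteq X$) and submodular ($f(A)+f(B)\ge f(A\cap B)+f(A\cup B)$ for all $A,B\subseteq X$). A family $F\subseteq 2^X$ is a filter of order $k+1$ on $(X,f)$ if: (Q0) $f(A)\le k$ for all $A\in F$; (Q1) if $A,B\in F$ and $f(A\cap B)\le k$ then $A\cap B\in F$; (Q2) if $A\in F$, $A\subseteq B\subseteq X$ and $f(B)\le k$ then $B\in F$; (Q3) $\emptyset\notin F$. An ultrafilter of order $k+1$ is a filter of order $k+1$ that also satisfies (Q4): for every $A\subseteq X$ with $f(A)\le k$, either $A\in F$ or $X\setminus A\in F$. -}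

module Defs where

open import Data.Nat using (ℕ; suc; _+_; _≤_)
open import Data.Fin.Subset using (Subset; _∩_; _∪_; ∁; ⊥; _⊆_)
open import Data.Product using (_×_)
open import Data.Sum using (_⊎_)
open import Relation.Nullary using (¬_)
open import Relation.Binary.PropositionalEquality using (_≡_)

-- The ground set X is modelled as Fin n; subsets of X are Subset n.

record IsConnectivity {n : ℕ} (f : Subset n → ℕ) : Set where
  field
    symmetric  : ∀ A → f A ≡ f (∁ A)
    submodular : ∀ A B → f (A ∩ B) + f (A ∪ B) ≤ f A + f B

-- A family of subsets is a predicate on subsets.
-- Filter of order k+1 on (X,f).
record IsFilter {n : ℕ} (f : Subset n → ℕ) (k : ℕ) (F : Subset n → Set) : Set where
  field
    Q0 : ∀ A → F A → f A ≤ k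
    Q1 : ∀ A B → F A → F B → f (A ∩ B) ≤ k → F (A ∩ B)
    Q2 : ∀ A B → F A → A ⊆ B → f B ≤ k → F B
    Q3 : ¬ F ⊥

record IsUltrafilter {n : ℕ} (f : Subset n → ℕ) (k : ℕ) (F : Subset n → Set) : Set where
  field
    isFilter : IsFilter f k F
    Q4 : ∀ A → f A ≤ k → F A ⊎ F (∁ A)

{-# OPTIONS --safe #-}
module Submission where

-- Every point x of X generates the principal ultrafilter {A : x ∈ A, f(A) ≤ k}.

open import Defs
open import Data.Nat using (ℕ; suc; _≤_)
open import Data.Fin using (Fin; zero)
open import Data.Fin.Subset using (Subset; _∈_; ∁)
open import Data.Fin.Subset.Properties using (∉⊥; x∈p∩q⁺; x∉p⇒x∈∁p; _∈?_)
open import Data.Product using (Σ; _×_; _,_)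
open import Data.Sum using (_⊎_; inj₁; inj₂)
open import Relation.Nullary using (yes; no)
open import Relation.Binary.PropositionalEquality using (_≡_; subst)

module _ {n : ℕ} (f : Subset n → ℕ) (k : ℕ) where

  principal : Fin n → Subset n → Set
  principal x A = x ∈ A × f A ≤ k

  principal-isFilter : ∀ x → IsFilter f k (principal x)
  principal-isFilter x = record
    { Q0 = λ { A (_ , fA≤k) → fA≤k }
    ; Q1 = λ { A B (x∈A , _) (x∈B , _) fA∩B≤k → x∈p∩q⁺ (x∈A , x∈B) , fA∩B≤k }
    ; Q2 = λ { A B (x∈A , _) A⊆B fB≤k → A⊆B x∈A , fB≤k }
    ; Q3 = λ { (x∈⊥ , _) → ∉⊥ x∈⊥ }
    }

  principal-isUltrafilter : (∀ A → f A ≡ f (∁ A)) → ∀ x → IsUltrafilter f k (principal x)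
  principal-isUltrafilter symmetric x = record
    { isFilter = principal-isFilter x
    ; Q4       = Q4
    }
    where
    Q4 : ∀ A → f A ≤ k → principal x A ⊎ principal x (∁ A)
    Q4 A fA≤k with x ∈? A
    ... | yes x∈A = inj₁ (x∈A , fA≤k)
    ... | no  x∉A = inj₂ (x∉p⇒x∈∁p x∉A , subst (_≤ k) (symmetric A) fA≤k)

mainTheorem2 : (n : ℕ) (f : Subset (suc n) → ℕ) → IsConnectivity f → (k : ℕ) →
                 Σ (Subset (suc n) → Set) (λ F → IsUltrafilter f k F)
mainTheorem2 n f conn k =
  principal f k zero , principal-isUltrafilter f k (IsConnectivity.symmetric conn) zero
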